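{- Let $G$ be a finite simple graph with $\mathrm{diam}(G)=3$ such that $D_2(G)$ is connected. Then $2\leqslant \mathrm{diam}(D_2(G))\leqslant 5$. Moreover, both bounds are sharp: there exist finite simple graphs $G$ with $\mathrm{diam}(G)=3$, $D_2(G)$ connected, and $\mathrm{diam}(D_2(G))=2$, and there exist such graphs with $\mathrm{diam}(D_2(G))=5$.
   Context: All graphs are finite, simple and undirected. For a graph $H$, $\mathrm{diam}(H)$ is the maximum over pairs of vertices of the length of a shortest path between them. The $2$-distance graph $D_2(G)$ has vertex set $V(G)$, two vertices being adjacent if and only if their distance in $G$ is exactly $2$. -}

module Defs where

open import Data.Nat using (ℕ; zero; suc; _<_; _≤_)
open import Data.Fin using (Fin)
open import Data.Bool using (Bool; true; false)
open import Data.Product using (Σ; _×_; ∃-syntax)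
open import Relation.Nullary using (¬_)
open import Relation.Binary.PropositionalEquality using (_≡_)

record SimpleGraph (n : ℕ) : Set where
  field
    adj   : Fin n → Fin n → Bool
    sym   : ∀ u v → adj u v ≡ adj v u
    irrefl : ∀ u → adj u u ≡ false
open SimpleGraph public

Adj : ∀ {n} → SimpleGraph n → Fin n → Fin n → Set
Adj G u v = adj G u v ≡ true

data Walk {n : ℕ} (R : Fin n → Fin n → Set) : ℕ → Fin n → Fin n → Set where
  nil  : ∀ {u} → Walk R zero u u
  cons : ∀ {k u w v} → R u w → Walk R k w v → Walk R (suc k) u v

-- dist_R(u,v) = d : there is a walk of length d and none shorter
-- (a shortest walk is a shortest path).
Dist : ∀ {n} → (Fin n → Fin n → Set) → ℕ → Fin n → Fin n → Set
Dist R d u v = Walk R d u v × (∀ k → k < d → ¬ Walk R k u v)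

Connected : ∀ {n} → (Fin n → Fin n → Set) → Set
Connected {n} R = ∀ (u v : Fin n) → ∃[ k ] Walk R k u v

-- diam = d : all distances are at most d, and some pair is at distance exactly d.
-- (This forces connectedness and a nonempty vertex set.)
Diam : ∀ {n} → (Fin n → Fin n → Set) → ℕ → Set
Diam {n} R d =
  (∀ (u v : Fin n) → ∃[ k ] (k ≤ d × Walk R k u v)) ×
  (∃[ u ] ∃[ v ] Dist R d u v)

D₂ : ∀ {n} → SimpleGraph n → Fin n → Fin n → Set
D₂ G u v = Dist (Adj G) 2 u v

-- Write d for the distance in G and d₂ for the distance in D₂(G), so d = 2 means d₂ = 1.
-- If d(u,z) = 3 but d₂(u,z) > 4, the set {u} ∪ N₂(u) ∪ {x ∈ N(u) : d(x,z) = 3} is closed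
-- under D₂-adjacency and misses z, contradicting connectivity; the key case is that no
-- vertex r can have d(u,r) = d(r,z) = 3, since each of u, z would reach r in two D₂-steps.
-- For an edge uv with some d(u,u′) = 3, either d(v,u′) = 2, or the vertex q with
-- d(u,q) = 2 on a geodesic from u to u′ has d(v,q) ∈ {2,3}; both give d₂(u,v) ≤ 5.
-- Otherwise u and v have eccentricity 2, and each is at distance 2 from an end of a
-- diametral pair of G. If they see different ends and d₂(u,v) > 5, the set
-- {u} ∪ N₂(u) ∪ {x ∈ N(u) ∩ N(v) : d₂(u,x) ≤ 2} is closed and misses v.
-- The ends of a diametral pair have d₂ ≥ 2, and the examples are decided by evaluation.

module Submission where

open import Defs
open import Data.Nat using (ℕ; zero; suc; _+_; _≤_; _<_; z≤n; s≤s; _≤?_; _<?_; _≡ᵇ_)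
open import Data.Nat.Properties
  using (≤-refl; ≤-trans; <⇒≤; m≤n⇒m≤1+n; m≤n⇒m<n∨m≡n; anyUpTo?; allUpTo?)
open import Data.Nat.Induction using (<-wellFounded)
open import Induction.WellFounded using (Acc; acc)
open import Data.Bool using (Bool; true; false; _∨_; _∧_)
open import Data.Bool.Properties using (∨-comm) renaming (_≟_ to _≟ᵇ_)
open import Data.Fin using (Fin; toℕ)
open import Data.Fin.Properties using (any?; all?) renaming (_≟_ to _≟ᶠ_)
open import Data.List using (List; []; _∷_)
open import Data.Bool.ListAction using (any)
open import Data.Product using (Σ; _×_; _,_; proj₁; proj₂; ∃-syntax)
open import Data.Sum using (_⊎_; inj₁; inj₂)
open import Data.Empty using (⊥; ⊥-elim)
open import Function using (_∘_)
open import Relation.Nullary using (¬_; Dec; yes; no)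
open import Relation.Nullary.Decidable using (_×-dec_; ¬?; map′; True; toWitness)
open import Relation.Binary.Definitions using (Symmetric; Decidable)
open import Relation.Binary.PropositionalEquality using (_≡_; refl; trans; subst) renaming (sym to ≡-sym)

Within : ∀ {n} → (Fin n → Fin n → Set) → ℕ → Fin n → Fin n → Set
Within R m x y = ∃[ k ] (k ≤ m × Walk R k x y)

module _ {n : ℕ} {R : Fin n → Fin n → Set} where

  _++_ : ∀ {i j x y z} → Walk R i x y → Walk R j y z → Walk R (i + j) x z
  nil      ++ q = q
  cons r p ++ q = cons r (p ++ q)

  snoc : ∀ {k x y z} → Walk R k x y → R y z → Walk R (suc k) x z
  snoc nil        r = cons r nil
  snoc (cons s p) r = cons s (snoc p r)

  reverse : Symmetric R → ∀ {k x y} → Walk R k x y → Walk R k y x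
  reverse R-sym nil        = nil
  reverse R-sym (cons r p) = snoc (reverse R-sym p) (R-sym r)

  Dist-sym : Symmetric R → ∀ {d} → Symmetric (Dist R d)
  Dist-sym R-sym (w , minimal) = reverse R-sym w , λ k k<d → minimal k k<d ∘ reverse R-sym

  Within-sym : Symmetric R → ∀ {m} → Symmetric (Within R m)
  Within-sym R-sym (k , k≤m , w) = k , k≤m , reverse R-sym w

  Within-mono : ∀ {m m' x y} → m ≤ m' → Within R m x y → Within R m' x y
  Within-mono m≤m' (k , k≤m , w) = k , ≤-trans k≤m m≤m' , w

  preserved : {P : Fin n → Set} → (∀ {x y} → P x → R x y → P y) →
              ∀ {k x y} → P x → Walk R k x y → P y
  preserved step Px nil        = Px
  preserved step Px (cons r w) = preserved step (step Px r) w

  Within-cons : ∀ {m x y z} → R x y → Within R m y z → Within R (suc m) x z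
  Within-cons r (k , k≤m , w) = suc k , s≤s k≤m , cons r w

  Within-snoc : ∀ {m x y z} → Within R m x y → R y z → Within R (suc m) x z
  Within-snoc (k , k≤m , w) r = suc k , s≤s k≤m , snoc w r

  within+minimal⇒Dist : ∀ {d x y} → Within R d x y → (∀ k → k < d → ¬ Walk R k x y) →
                        Dist R d x y
  within+minimal⇒Dist (k , k≤d , w) minimal with m≤n⇒m<n∨m≡n k≤d
  ... | inj₁ k<d  = ⊥-elim (minimal k k<d w)
  ... | inj₂ refl = w , minimal

Diam⇒Connected : ∀ {n} {R : Fin n → Fin n → Set} {d} → Diam R d → Connected R
Diam⇒Connected (within , _) u v = let k , _ , w = within u v in k , w

module _ {n : ℕ} {R : Fin n → Fin n → Set} (R? : Decidable R) where

  walk? : ∀ k → Decidable (Walk R k)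
  walk? zero x y with x ≟ᶠ y
  ... | yes refl = yes nil
  ... | no x≢y   = no λ { nil → x≢y refl }
  walk? (suc k) x y with any? (λ w → R? x w ×-dec walk? k w y)
  ... | yes (w , r , p) = yes (cons r p)
  ... | no ∄w           = no λ { (cons r p) → ∄w (_ , r , p) }

  minimal? : ∀ d x y → Dec (∀ k → k < d → ¬ Walk R k x y)
  minimal? d x y = map′ (λ f k k<d → f k<d) (λ f {k} → f k) (allUpTo? (λ k → ¬? (walk? k x y)) d)

  within? : ∀ m → Decidable (Within R m)
  within? m x y = map′ (λ { (k , s≤s k≤m , w) → k , k≤m , w })
                       (λ { (k , k≤m , w) → k , s≤s k≤m , w })
                       (anyUpTo? (λ k → walk? k x y) (suc m))

  dist? : ∀ d → Decidable (Dist R d)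
  dist? d x y = walk? d x y ×-dec minimal? d x y

  diam? : ∀ d → Dec (Diam R d)
  diam? d = all? (λ u → all? (λ v → within? d u v)) ×-dec any? (λ u → any? (λ v → dist? d u v))

  shortest : ∀ {k x y} → Walk R k x y → ∃[ d ] (d ≤ k × Dist R d x y)
  shortest {k} w = go (<-wellFounded k) w
    where
    go : ∀ {k x y} → Acc _<_ k → Walk R k x y → ∃[ d ] (d ≤ k × Dist R d x y)
    go {k} {x} {y} (acc rec) w with anyUpTo? (λ j → walk? j x y) k
    ... | no ∄shorter = k , ≤-refl , w , λ j j<k w' → ∄shorter (j , j<k , w')
    ... | yes (j , j<k , w') with go (rec j<k) w'
    ...   | d , d≤j , dist = d , ≤-trans d≤j (<⇒≤ j<k) , dist

  -- If every pair is within B but none needs all of B, every pair is within B - 1.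
  diameter-between : ∀ {L} B → L ≤ B → (∀ u v → Within R B u v) →
                     ∀ {a b} → (∀ k → k < L → ¬ Walk R k a b) →
                     ∃[ d ] (Diam R d × L ≤ d × d ≤ B)
  diameter-between {L} B L≤B within {a} {b} far
    with any? (λ u → any? (λ v → minimal? B u v))
  ... | yes (u , v , minimal) =
    B , (within , u , v , within+minimal⇒Dist (within u v) minimal) , L≤B , ≤-refl
  ... | no ∄diametral with m≤n⇒m<n∨m≡n L≤B
  ...   | inj₂ refl = ⊥-elim (∄diametral (a , b , far))
  diameter-between (suc B) _ within far | no ∄diametral | inj₁ (s≤s L≤B) =
    let d , diam , L≤d , d≤B = diameter-between B L≤B shorter far
    in  d , diam , L≤d , m≤n⇒m≤1+n d≤B
    where
    shorter : ∀ u v → Within R B u v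
    shorter u v with within? B u v
    ... | yes w = w
    ... | no ¬w = ⊥-elim (∄diametral (u , v , λ { k (s≤s k≤B) w → ¬w (k , k≤B , w) }))

Adj? : ∀ {n} (G : SimpleGraph n) → Decidable (Adj G)
Adj? G x y = adj G x y ≟ᵇ true

module DiameterThree {n : ℕ} (G : SimpleGraph n) (diam3 : Diam (Adj G) 3)
                     (connected : Connected (D₂ G)) where

  _~_ : Fin n → Fin n → Set
  _~_ = Adj G

  ~-sym : Symmetric _~_
  ~-sym {x} {y} e = trans (sym G y x) e

  ~-irrefl : ∀ {x} → ¬ (x ~ x)
  ~-irrefl {x} e with () ← trans (≡-sym (irrefl G x)) e

  D : ℕ → Fin n → Fin n → Set
  D = Dist _~_

  D-sym : ∀ {d} → Symmetric (D d)
  D-sym = Dist-sym ~-sym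

  shortcut : ∀ {j k x y} → D k x y → Walk _~_ j x y → {True (j <? k)} → ⊥
  shortcut (_ , minimal) w {j<k} = minimal _ (toWitness j<k) w

  data Distance (x y : Fin n) : Set where
    same     : x ≡ y → Distance x y
    adjacent : x ~ y → Distance x y
    two      : D 2 x y → Distance x y
    three    : D 3 x y → Distance x y

  classify : ∀ x y → Distance x y
  classify x y with proj₁ diam3 x y
  ... | k , k≤3 , w with shortest (Adj? G) w
  ...   | d , d≤k , dist = bounded (≤-trans d≤k k≤3) dist
    where
    bounded : ∀ {d} → d ≤ 3 → D d x y → Distance x y
    bounded {0} _ (nil , _)        = same refl
    bounded {1} _ (cons e nil , _) = adjacent e
    bounded {2} _ dist             = two dist
    bounded {3} _ dist             = three dist
    bounded {suc (suc (suc (suc _)))} (s≤s (s≤s (s≤s ()))) _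

  Within₂ : ℕ → Fin n → Fin n → Set
  Within₂ = Within (D₂ G)

  beyond : ∀ {m k x y} → ¬ Within₂ m x y → Walk (D₂ G) k x y → {True (k ≤? m)} → ⊥
  beyond far w {k≤m} = far (_ , toWitness k≤m , w)

  record Stretched (u z : Fin n) : Set where
    field
      three-apart : D 3 u z
      far         : ¬ Within₂ 4 u z

  swap : ∀ {u z} → Stretched u z → Stretched z u
  swap uz = record { three-apart = D-sym three-apart ; far = far ∘ Within-sym D-sym }
    where open Stretched uz

  module _ {u z : Fin n} (uz : Stretched u z) where
    open Stretched uz

    near-start : ∀ {y} → u ~ y → D 3 y z → Walk (D₂ G) 2 u y
    near-start {y} uy yz with proj₁ yz
    ... | cons {w = s} e₁ (cons {w = t} e₂ (cons e₃ nil)) with classify y t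
    ...   | same refl    = ⊥-elim (shortcut yz (cons e₃ nil))
    ...   | adjacent yt  = ⊥-elim (shortcut yz (cons yt (cons e₃ nil)))
    ...   | three yt     = ⊥-elim (shortcut yt (cons e₁ (cons e₂ nil)))
    ...   | two yt with classify u t
    ...     | same refl   = ⊥-elim (shortcut three-apart (cons e₃ nil))
    ...     | adjacent ut = ⊥-elim (shortcut three-apart (cons ut (cons e₃ nil)))
    ...     | two ut      = cons ut (cons (D-sym yt) nil)
    ...     | three ut with classify u s
    ...       | same refl   = ⊥-elim (shortcut ut (cons e₂ nil))
    ...       | adjacent us = ⊥-elim (shortcut ut (cons us (cons e₂ nil)))
    ...       | three us    = ⊥-elim (shortcut us (cons uy (cons e₁ nil)))
    ...       | two us with classify s z
    ...         | same refl   = ⊥-elim (shortcut yz (cons e₁ nil))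
    ...         | adjacent sz = ⊥-elim (shortcut yz (cons e₁ (cons sz nil)))
    ...         | three sz    = ⊥-elim (shortcut sz (cons e₂ (cons e₃ nil)))
    ...         | two sz      = ⊥-elim (beyond far (cons us (cons sz nil)))

    step-toward-start : ∀ {r} → D 3 u r → D 3 r z → ∃[ s ] (r ~ s × D 2 u s × D 3 s z)
    step-toward-start ur rz with proj₁ (D-sym ur)
    ... | cons {w = s} e₁ (cons e₂ (cons e₃ nil)) with classify u s
    ...   | same refl   = ⊥-elim (shortcut ur (cons (~-sym e₁) nil))
    ...   | adjacent us = ⊥-elim (shortcut ur (cons us (cons (~-sym e₁) nil)))
    ...   | three us    = ⊥-elim (shortcut us (cons (~-sym e₃) (cons (~-sym e₂) nil)))
    ...   | two us with classify s z
    ...     | same refl   = ⊥-elim (shortcut rz (cons e₁ nil))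
    ...     | adjacent sz = ⊥-elim (shortcut rz (cons e₁ (cons sz nil)))
    ...     | two sz      = ⊥-elim (beyond far (cons us (cons sz nil)))
    ...     | three sz    = s , e₁ , us , sz

  near-end : ∀ {u z y} → Stretched u z → D 3 u y → y ~ z → Walk (D₂ G) 2 y z
  near-end uz uy yz = reverse D-sym (near-start (swap uz) (~-sym yz) (D-sym uy))

  module _ {u z : Fin n} (uz : Stretched u z) where
    open Stretched uz

    far-vertex-reached : ∀ {r} → D 3 u r → D 3 r z → Walk (D₂ G) 2 u r
    far-vertex-reached {r} ur rz with step-toward-start uz ur rz
    ... | m , rm , um , mz with proj₁ rz
    ...   | cons {w = s′} e₁ (cons {w = t} e₂ (cons e₃ nil)) with classify s′ z | classify r t
    ...     | same refl    | _           = ⊥-elim (shortcut rz (cons e₁ nil))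
    ...     | adjacent s′z | _           = ⊥-elim (shortcut rz (cons e₁ (cons s′z nil)))
    ...     | three s′z    | _           = ⊥-elim (shortcut s′z (cons e₂ (cons e₃ nil)))
    ...     | two _        | same refl   = ⊥-elim (shortcut rz (cons e₃ nil))
    ...     | two _        | adjacent rt = ⊥-elim (shortcut rz (cons rt (cons e₃ nil)))
    ...     | two _        | three rt    = ⊥-elim (shortcut rt (cons e₁ (cons e₂ nil)))
    ...     | two s′z      | two rt with classify m s′ | classify m t
    ...       | same refl    | _           = ⊥-elim (shortcut mz (proj₁ s′z))
    ...       | two ms′      | _           = ⊥-elim (beyond far (cons um (cons ms′ (cons s′z nil))))
    ...       | three ms′    | _           = ⊥-elim (shortcut ms′ (cons (~-sym rm) (cons e₁ nil)))
    ...       | adjacent _   | same refl   = ⊥-elim (shortcut mz (cons e₃ nil))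
    ...       | adjacent _   | adjacent mt = ⊥-elim (shortcut mz (cons mt (cons e₃ nil)))
    ...       | adjacent ms′ | three mt    = ⊥-elim (shortcut mt (cons ms′ (cons e₂ nil)))
    ...       | adjacent _   | two mt with classify u t
    ...         | same refl   = ⊥-elim (shortcut three-apart (cons e₃ nil))
    ...         | adjacent ut = ⊥-elim (shortcut three-apart (cons ut (cons e₃ nil)))
    ...         | two ut      = cons ut (cons (D-sym rt) nil)
    ...         | three ut    = ⊥-elim (beyond far (cons um (cons mt (near-end uz ut e₃))))

  no-vertex-far-from-both : ∀ {u z r} → Stretched u z → D 3 u r → D 3 r z → ⊥
  no-vertex-far-from-both uz ur rz =
    beyond (Stretched.far uz)
      (far-vertex-reached uz ur rz ++ reverse D-sym (far-vertex-reached (swap uz) (D-sym rz) (D-sym ur)))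

  module _ {u z : Fin n} (uz : Stretched u z) where
    open Stretched uz

    data Cluster (x : Fin n) : Set where
      start     : u ≡ x → Cluster x
      second    : D 2 u x → Cluster x
      neighbour : u ~ x → D 3 x z → Cluster x

    second-step : ∀ {x w} → D 2 u x → D 2 x w → Cluster w
    second-step {w = w} ux xw with classify u w | classify w z
    ... | same refl   | _           = start refl
    ... | two uw      | _           = second uw
    ... | _           | two wz      = ⊥-elim (beyond far (cons ux (cons xw (cons wz nil))))
    ... | adjacent uw | same refl   = ⊥-elim (shortcut three-apart (cons uw nil))
    ... | adjacent uw | adjacent wz = ⊥-elim (shortcut three-apart (cons uw (cons wz nil)))
    ... | adjacent uw | three wz    = neighbour uw wz
    ... | three _     | same refl   = ⊥-elim (beyond far (cons ux (cons xw nil)))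
    ... | three uw    | adjacent wz = ⊥-elim (beyond far (cons ux (cons xw (near-end uz uw wz))))
    ... | three uw    | three wz    = ⊥-elim (no-vertex-far-from-both uz uw wz)

    no-far-end-neighbour : ∀ {x w} → u ~ x → D 3 x z → D 2 x w → D 3 u w → w ~ z → ⊥
    no-far-end-neighbour ux xz xw uw wz with proj₁ xw
    ... | cons {w = m} xm (cons mw nil) with classify u m | classify m z
    ...   | same refl   | _           = shortcut uw (cons mw nil)
    ...   | adjacent um | _           = shortcut uw (cons um (cons mw nil))
    ...   | three um    | _           = shortcut um (cons ux (cons xm nil))
    ...   | two _       | same refl   = shortcut xz (cons xm nil)
    ...   | two _       | adjacent mz = shortcut xz (cons xm (cons mz nil))
    ...   | two _       | three mz    = shortcut mz (cons mw (cons wz nil))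
    ...   | two um      | two mz      = beyond far (cons um (cons mz nil))

    neighbour-step : ∀ {x w} → u ~ x → D 3 x z → D 2 x w → Cluster w
    neighbour-step {w = w} ux xz xw with classify u w | classify w z
    ... | same refl   | _           = ⊥-elim (shortcut xw (cons (~-sym ux) nil))
    ... | two uw      | _           = second uw
    ... | _           | same refl   = ⊥-elim (shortcut xz (proj₁ xw))
    ... | _           | two wz      = ⊥-elim (beyond far (near-start uz ux xz ++ cons xw (cons wz nil)))
    ... | adjacent uw | adjacent wz = ⊥-elim (shortcut three-apart (cons uw (cons wz nil)))
    ... | adjacent uw | three wz    = neighbour uw wz
    ... | three uw    | adjacent wz = ⊥-elim (no-far-end-neighbour ux xz xw uw wz)
    ... | three uw    | three wz    = ⊥-elim (no-vertex-far-from-both uz uw wz)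

    cluster-step : ∀ {x w} → Cluster x → D 2 x w → Cluster w
    cluster-step (start refl)      = second
    cluster-step (second ux)       = second-step ux
    cluster-step (neighbour ux xz) = neighbour-step ux xz

    end∉cluster : ¬ Cluster z
    end∉cluster (start refl)      = shortcut three-apart nil
    end∉cluster (second uz′)      = shortcut three-apart (proj₁ uz′)
    end∉cluster (neighbour uz′ _) = shortcut three-apart (cons uz′ nil)

  no-stretched-pair : ∀ {u z} → ¬ Stretched u z
  no-stretched-pair {u} {z} uz =
    end∉cluster uz (preserved (cluster-step uz) (start refl) (proj₂ (connected u z)))

  three-apart⇒within-four : ∀ {u z} → D 3 u z → Within₂ 4 u z
  three-apart⇒within-four {u} {z} uz with within? (dist? (Adj? G) 2) 4 u z
  ... | yes within = within
  ... | no far     = ⊥-elim (no-stretched-pair (record { three-apart = uz ; far = far }))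

  within-five-of-eccentric : ∀ {u v u′} → u ~ v → D 3 u u′ → Within₂ 5 u v
  within-five-of-eccentric {u} {v} {u′} uv uu′ with classify v u′
  ... | same refl    = ⊥-elim (shortcut uu′ (cons uv nil))
  ... | adjacent vu′ = ⊥-elim (shortcut uu′ (cons uv (cons vu′ nil)))
  ... | two vu′      = Within-snoc (three-apart⇒within-four uu′) (D-sym vu′)
  ... | three vu′ with proj₁ uu′
  ...   | cons e₁ (cons {w = q} e₂ (cons e₃ nil)) with classify u q | classify v q
  ...     | same refl   | _           = ⊥-elim (shortcut uu′ (cons e₃ nil))
  ...     | adjacent uq | _           = ⊥-elim (shortcut uu′ (cons uq (cons e₃ nil)))
  ...     | three uq    | _           = ⊥-elim (shortcut uq (cons e₁ (cons e₂ nil)))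
  ...     | two _       | same refl   = ⊥-elim (shortcut vu′ (cons e₃ nil))
  ...     | two _       | adjacent vq = ⊥-elim (shortcut vu′ (cons vq (cons e₃ nil)))
  ...     | two uq      | two vq      = 2 , s≤s (s≤s z≤n) , cons uq (cons (D-sym vq) nil)
  ...     | two uq      | three vq    = Within-cons uq (Within-sym D-sym (three-apart⇒within-four vq))

  Ecc≤2 : Fin n → Set
  Ecc≤2 x = ∀ y → ¬ D 3 x y

  sees-diametral-pair : ∀ {a b x} → D 3 a b → Ecc≤2 x → D 2 x a ⊎ D 2 x b
  sees-diametral-pair {a} {b} {x} ab ecc with classify x a | classify x b
  ... | three xa    | _           = ⊥-elim (ecc _ xa)
  ... | _           | three xb    = ⊥-elim (ecc _ xb)
  ... | two xa      | _           = inj₁ xa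
  ... | _           | two xb      = inj₂ xb
  ... | same refl   | _           = ⊥-elim (ecc _ ab)
  ... | _           | same refl   = ⊥-elim (ecc _ (D-sym ab))
  ... | adjacent xa | adjacent xb = ⊥-elim (shortcut ab (cons (~-sym xa) (cons xb nil)))

  module _ {u v a b : Fin n} (uv : u ~ v) (ecc-u : Ecc≤2 u) (ecc-v : Ecc≤2 v) (ab : D 3 a b)
           (ua : D 2 u a) (vb : D 2 v b) (ub : u ~ b) (va : v ~ a) (far : ¬ Within₂ 5 u v) where

    common-neighbour : ∀ {w} → u ~ w → v ~ w → D 2 w a ⊎ D 2 w b
    common-neighbour {w} uw vw with classify w a | classify w b
    ... | two wa      | _           = inj₁ wa
    ... | _           | two wb      = inj₂ wb
    ... | same refl   | _           = ⊥-elim (shortcut ua (cons uw nil))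
    ... | three wa    | _           = ⊥-elim (shortcut wa (cons (~-sym vw) (cons va nil)))
    ... | _           | same refl   = ⊥-elim (shortcut vb (cons vw nil))
    ... | _           | three wb    = ⊥-elim (shortcut wb (cons (~-sym uw) (cons ub nil)))
    ... | adjacent wa | adjacent wb = ⊥-elim (shortcut ab (cons (~-sym wa) (cons wb nil)))

    data Basin (x : Fin n) : Set where
      start  : u ≡ x → Basin x
      second : D 2 u x → Basin x
      common : u ~ x → v ~ x → Walk (D₂ G) 2 u x → Basin x

    basin-step : ∀ {x w} → Basin x → D 2 x w → Basin w
    basin-step (start refl) = second
    basin-step {w = w} (second ux) xw with classify u w | classify v w
    ... | same refl   | _           = start refl
    ... | two uw      | _           = second uw
    ... | three uw    | _           = ⊥-elim (ecc-u _ uw)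
    ... | _           | three vw    = ⊥-elim (ecc-v _ vw)
    ... | adjacent _  | same refl   = ⊥-elim (beyond far (cons ux (cons xw nil)))
    ... | adjacent _  | two vw      = ⊥-elim (beyond far (cons ux (cons xw (cons (D-sym vw) nil))))
    ... | adjacent uw | adjacent vw = common uw vw (cons ux (cons xw nil))
    basin-step {w = w} (common ux vx uyx) xw with classify u w | classify v w
    ... | same refl   | _           = start refl
    ... | two uw      | _           = second uw
    ... | three uw    | _           = ⊥-elim (ecc-u _ uw)
    ... | _           | three vw    = ⊥-elim (ecc-v _ vw)
    ... | adjacent _  | same refl   = ⊥-elim (shortcut xw (cons (~-sym vx) nil))
    ... | adjacent _  | two vw      = ⊥-elim (beyond far (uyx ++ cons xw (cons (D-sym vw) nil)))
    ... | adjacent uw | adjacent vw with common-neighbour uw vw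
    ...   | inj₁ wa = common uw vw (cons ua (cons (D-sym wa) nil))
    ...   | inj₂ wb = ⊥-elim (beyond far (uyx ++ cons xw (cons wb (cons (D-sym vb) nil))))

    v∉basin : ¬ Basin v
    v∉basin (start refl)    = ~-irrefl uv
    v∉basin (second uv′)    = shortcut uv′ (cons uv nil)
    v∉basin (common _ vv _) = ~-irrefl vv

    no-crossing : ⊥
    no-crossing = v∉basin (preserved basin-step (start refl) (proj₂ (connected u v)))

  within-five-of-crossing : ∀ {u v a b} → u ~ v → Ecc≤2 u → Ecc≤2 v →
                            D 3 a b → D 2 u a → D 2 v b → Within₂ 5 u v
  within-five-of-crossing {u} {v} {a} {b} uv ecc-u ecc-v ab ua vb
    with within? (dist? (Adj? G) 2) 5 u v
  ... | yes within = within
  ... | no far with classify u b | classify v a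
  ...   | same refl   | _           = ⊥-elim (shortcut vb (cons (~-sym uv) nil))
  ...   | two ub      | _           = ⊥-elim (beyond far (cons ub (cons (D-sym vb) nil)))
  ...   | three ub    | _           = ⊥-elim (ecc-u _ ub)
  ...   | _           | same refl   = ⊥-elim (shortcut ua (cons uv nil))
  ...   | _           | two va      = ⊥-elim (beyond far (cons ua (cons (D-sym va) nil)))
  ...   | _           | three va    = ⊥-elim (ecc-v _ va)
  ...   | adjacent ub | adjacent va = ⊥-elim (no-crossing uv ecc-u ecc-v ab ua vb ub va far)

  within-five-of-central : ∀ {u v} → u ~ v → Ecc≤2 u → Ecc≤2 v → Within₂ 5 u v
  within-five-of-central uv ecc-u ecc-v with proj₂ diam3
  ... | a , b , ab with sees-diametral-pair ab ecc-u | sees-diametral-pair ab ecc-v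
  ...   | inj₁ ua | inj₁ va = 2 , s≤s (s≤s z≤n) , cons ua (cons (D-sym va) nil)
  ...   | inj₂ ub | inj₂ vb = 2 , s≤s (s≤s z≤n) , cons ub (cons (D-sym vb) nil)
  ...   | inj₁ ua | inj₂ vb = within-five-of-crossing uv ecc-u ecc-v ab ua vb
  ...   | inj₂ ub | inj₁ va = within-five-of-crossing uv ecc-u ecc-v (D-sym ab) ub va

  within-five-of-adjacent : ∀ {u v} → u ~ v → Within₂ 5 u v
  within-five-of-adjacent {u} {v} uv with any? (dist? (Adj? G) 3 u) | any? (dist? (Adj? G) 3 v)
  ... | yes (_ , uu′) | _             = within-five-of-eccentric uv uu′
  ... | no _          | yes (_ , vv′) = Within-sym D-sym (within-five-of-eccentric (~-sym uv) vv′)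
  ... | no ∄u′        | no ∄v′        =
    within-five-of-central uv (λ u′ uu′ → ∄u′ (u′ , uu′)) (λ v′ vv′ → ∄v′ (v′ , vv′))

  within-five : ∀ u v → Within₂ 5 u v
  within-five u v with classify u v
  ... | same refl   = 0 , z≤n , nil
  ... | adjacent uv = within-five-of-adjacent uv
  ... | two uv      = 1 , s≤s z≤n , cons uv nil
  ... | three uv    = Within-mono (m≤n⇒m≤1+n ≤-refl) (three-apart⇒within-four uv)

  three-apart⇒D₂-far : ∀ {a b} → D 3 a b → ∀ k → k < 2 → ¬ Walk (D₂ G) k a b
  three-apart⇒D₂-far ab 0 _ nil          = shortcut ab nil
  three-apart⇒D₂-far ab 1 _ (cons d nil) = shortcut ab (proj₁ d)
  three-apart⇒D₂-far ab (suc (suc _)) (s≤s (s≤s ())) _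

diameter-of-D₂ : ∀ (n : ℕ) (G : SimpleGraph n) → Diam (Adj G) 3 → Connected (D₂ G) →
                 ∃[ d ] (Diam (D₂ G) d × 2 ≤ d × d ≤ 5)
diameter-of-D₂ n G diam3 connected =
  let a , b , ab = proj₂ diam3
  in  diameter-between (dist? (Adj? G) 2) 5 (s≤s (s≤s z≤n)) within-five (three-apart⇒D₂-far ab)
  where open DiameterThree G diam3 connected

listed : List (ℕ × ℕ) → ℕ → ℕ → Bool
listed es a b = any (λ { (c , d) → (a ≡ᵇ c) ∧ (b ≡ᵇ d) }) es

fromEdges : ∀ n (es : List (ℕ × ℕ)) →
            {True (all? λ (u : Fin n) → listed es (toℕ u) (toℕ u) ≟ᵇ false)} → SimpleGraph n
fromEdges n es {loopless} = record
  { adj    = λ u v → listed es (toℕ u) (toℕ v) ∨ listed es (toℕ v) (toℕ u)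
  ; sym    = λ u v → ∨-comm (listed es (toℕ u) (toℕ v)) _
  ; irrefl = λ u → subst (λ b → b ∨ b ≡ false) (≡-sym (toWitness loopless u)) refl
  }

D₂-diameter-two : SimpleGraph 7
D₂-diameter-two = fromEdges 7
  ((0 , 4) ∷ (0 , 5) ∷ (0 , 6) ∷ (1 , 2) ∷ (1 , 3) ∷ (1 , 6) ∷ (2 , 5) ∷ (3 , 4) ∷ [])

D₂-diameter-five : SimpleGraph 6
D₂-diameter-five = fromEdges 6
  ((0 , 1) ∷ (0 , 3) ∷ (0 , 5) ∷ (1 , 2) ∷ (1 , 3) ∷ (1 , 4) ∷ (2 , 3) ∷ (2 , 4) ∷ [])

decided-example : ∀ {n} (G : SimpleGraph n) d →
                  {True (diam? (Adj? G) 3 ×-dec diam? (dist? (Adj? G) 2) d)} →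
                  Diam (Adj G) 3 × Connected (D₂ G) × Diam (D₂ G) d
decided-example G d {ok} = let diam3 , diamD₂ = toWitness ok in diam3 , Diam⇒Connected diamD₂ , diamD₂

corollary2p9 : (∀ (n : ℕ) (G : SimpleGraph n) → Diam (Adj G) 3 → Connected (D₂ G) →
    ∃[ d ] (Diam (D₂ G) d × 2 ≤ d × d ≤ 5))
    ×
    (∃[ n ] Σ (SimpleGraph n) λ G →
    Diam (Adj G) 3 × Connected (D₂ G) × Diam (D₂ G) 2)
    ×
    (∃[ n ] Σ (SimpleGraph n) λ G →
    Diam (Adj G) 3 × Connected (D₂ G) × Diam (D₂ G) 5)
corollary2p9 =
  diameter-of-D₂ ,
  (7 , D₂-diameter-two , decided-example D₂-diameter-two 2) ,
  (6 , D₂-diameter-five , decided-example D₂-diameter-five 5)
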